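{- Let $G$ be a finite simple connected graph satisfying property (P3), and let $R$ be an induced subgraph of $G$ witnessing (P3). Let $\mathcal{J}=\{C(c,x): c\in V(R),\ x\in V(G),\ d(c,x)\ge 2\}$. If $J_1,J_2\in\mathcal{J}$, then $J_1$ and $J_2$ are either identical or disjoint.
   Context: $d$ is the distance in $G$, $N(x)$ the neighbourhood, $N[x]=N(x)\cup\{x\}$, $N[R]=\bigcup_{r\in V(R)}N[r]$. For $d(c,x)\ge 2$: $N(c,x)=\{v\in N(c): d(c,x)=1+d(v,x)\}$ and $N_R(c,x)=N(c,x)\cap V(R)$. An induced subgraph $R$ witnesses property (P3) if $N[R]=V(G)$ and for all $c\in V(R)$, $x\in V(G)$ with $d(c,x)\ge 2$, there exists $c'\in N_R(c,x)$ such that for every $y\in V(G)$ with $d(c',y)\ge 2$, either $d(c,y)=d(c,c')+d(c',y)$ or $d(x,y)=d(x,c')+d(c',y)$. For $c\in V(R)$, $x\in V(G)$ with $d(c,x)\ge2$, $C(c,x)=\{u\in N_R(c,x): N[u]\supseteq N[v]\text{ for all }v\in N(c,x)\}$. -}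

module Defs where

open import Data.Nat using (ℕ; zero; suc; _+_; _≤_)
open import Data.Fin using (Fin)
open import Data.Fin.Properties using (_≟_)
open import Data.Bool using (Bool; true; false; _∨_; _∧_; if_then_else_)
open import Data.Bool.ListAction using (any)
open import Data.List using () renaming (allFin to finList)
open import Data.Product using (Σ; _×_; ∃)
open import Data.Sum using (_⊎_)
open import Relation.Nullary using (¬_)
open import Relation.Nullary.Decidable using (⌊_⌋)
open import Relation.Binary.PropositionalEquality using (_≡_)

record Graph : Set where
  field
    n      : ℕ
    adj    : Fin n → Fin n → Bool
    sym    : ∀ u v → adj u v ≡ adj v u
    irrefl : ∀ u → adj u u ≡ false
open Graph public

module _ (G : Graph) where
  private
    V = Fin (n G)
    A = adj G

  reach : ℕ → V → V → Bool
  reach zero    u v = ⌊ u ≟ v ⌋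
  reach (suc k) u v = reach k u v ∨ any (λ w → A u w ∧ reach k w v) (finList (n G))

  -- least k ≤ fuel with f k ≡ true (or fuel if none)
  least : (ℕ → Bool) → ℕ → ℕ
  least f zero    = zero
  least f (suc m) = if f zero then zero else suc (least (λ k → f (suc k)) m)

  -- graph distance d(u,v): the least length of a walk from u to v
  -- (for a connected graph on n vertices this is always < n)
  dist : V → V → ℕ
  dist u v = least (λ k → reach k u v) (n G)

  Connected : Set
  Connected = ∀ u v → ∃ λ k → reach k u v ≡ true

  InClosedNbhd : V → V → Set
  InClosedNbhd u w = w ≡ u ⊎ A u w ≡ true

  InNcx : V → V → V → Set
  InNcx c x v = A c v ≡ true × dist c x ≡ suc (dist v x)

  -- An induced subgraph R is given by its vertex set (membership predicate).
  -- v ∈ N_R(c,x)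
  InNRcx : (V → Bool) → V → V → V → Set
  InNRcx R c x v = R v ≡ true × InNcx c x v

  WitnessesP3 : (V → Bool) → Set
  WitnessesP3 R =
    (∀ w → ∃ λ r → R r ≡ true × InClosedNbhd r w) ×
    (∀ c x → R c ≡ true → 2 ≤ dist c x →
      ∃ λ c' → InNRcx R c x c' ×
        (∀ y → 2 ≤ dist c' y →
           dist c y ≡ dist c c' + dist c' y ⊎ dist x y ≡ dist x c' + dist c' y))

  SatisfiesP3 : Set
  SatisfiesP3 = ∃ λ R → WitnessesP3 R

  InC : (V → Bool) → V → V → V → Set
  InC R c x u = InNRcx R c x u ×
    (∀ v → InNcx c x v → ∀ w → InClosedNbhd v w → InClosedNbhd u w)

-- Two members u, u' of C(c,x) dominate each other's closed neighbourhoods, so they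
-- are closed twins: N[u] = N[u']. Closed twins have the same distance to every
-- other vertex, so u ∈ N(c,x) forces u' ∈ N(c,x), and domination of N(c,x) passes
-- from u to u'. Hence if u ∈ C(c₁,x₁) ∩ C(c₂,x₂), every u' ∈ C(c₁,x₁) is a twin of u
-- and lies in C(c₂,x₂).
module Submission where

open import Defs hiding (sym)
open import Data.Nat using (ℕ; zero; suc; _≤_; z≤n; s≤s)
open import Data.Nat.Properties using (≤-trans; ≤-antisym; ≤-reflexive; <-irrefl)
import Data.Nat.Properties as ℕ
open import Data.Fin using (Fin)
open import Data.Fin.Properties using (any?; all?)
import Data.Fin.Properties as Fin
open import Data.Bool using (Bool; true; false; T; _∧_)
open import Data.Bool.Properties using (T-≡; T-∨; T-∧)
import Data.Bool.Properties as Bool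
open import Data.List using () renaming (allFin to finList)
open import Data.List.Relation.Unary.Any using (satisfied)
open import Data.List.Relation.Unary.Any.Properties using (any⁺; any⁻)
open import Data.List.Membership.Propositional using (lose)
open import Data.List.Membership.Propositional.Properties using (∈-allFin)
open import Data.Product using (_×_; _,_; ∃)
open import Data.Sum using (_⊎_; inj₁; inj₂)
open import Relation.Nullary using (¬_; Dec; yes; no; contradiction)
open import Relation.Nullary.Decidable using (_×-dec_; _⊎-dec_; _→-dec_)
open import Relation.Binary.PropositionalEquality using (_≡_; _≢_; refl; cong; sym; trans)
open import Function.Bundles using (_⇔_; mk⇔; Equivalence)

open Equivalence using (to; from)

module _ (G : Graph) where
  private
    V = Fin (n G)

  least-≤ : ∀ (f : ℕ → Bool) m k → f k ≡ true → least G f m ≤ k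
  least-≤ f zero    k       fk = z≤n
  least-≤ f (suc m) k       fk with f zero in f0
  ... | true = z≤n
  least-≤ f (suc m) zero    fk | false = contradiction (trans (sym f0) fk) λ ()
  least-≤ f (suc m) (suc k) fk | false = s≤s (least-≤ (λ j → f (suc j)) m k fk)

  least-antitone : ∀ (f g : ℕ → Bool) m → (∀ k → f k ≡ true → g k ≡ true) →
    least G g m ≤ least G f m
  least-antitone f g zero    f⇒g = z≤n
  least-antitone f g (suc m) f⇒g with g zero in g0 | f zero in f0
  ... | true  | _     = z≤n
  ... | false | true  = contradiction (trans (sym g0) (f⇒g zero f0)) λ ()
  ... | false | false =
    s≤s (least-antitone (λ j → f (suc j)) (λ j → g (suc j)) m (λ k → f⇒g (suc k)))

  reach-refl : ∀ u → reach G 0 u u ≡ true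
  reach-refl u with u Fin.≟ u
  ... | yes _  = refl
  ... | no u≢u = contradiction refl u≢u

  reach-zero⁻ : ∀ {u y} → reach G 0 u y ≡ true → u ≡ y
  reach-zero⁻ {u} {y} r with u Fin.≟ y
  ... | yes u≡y = u≡y

  reach-weaken : ∀ k {u y} → reach G k u y ≡ true → reach G (suc k) u y ≡ true
  reach-weaken k uy = to T-≡ (from T-∨ (inj₁ (from T-≡ uy)))

  reach-suc⁺ : ∀ k {u w y} → adj G u w ≡ true → reach G k w y ≡ true →
    reach G (suc k) u y ≡ true
  reach-suc⁺ k {u} {w} {y} uw wy = to T-≡ (from T-∨ (inj₂ (any⁺ _ (lose (∈-allFin w) uw∧wy))))
    where
    uw∧wy : T (adj G u w ∧ reach G k w y)
    uw∧wy = from T-∧ (from T-≡ uw , from T-≡ wy)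

  reach-suc⁻ : ∀ k {u y} → reach G (suc k) u y ≡ true →
    reach G k u y ≡ true ⊎ ∃ λ w → adj G u w ≡ true × reach G k w y ≡ true
  reach-suc⁻ k r with to T-∨ (from T-≡ r)
  ... | inj₁ uy = inj₁ (to T-≡ uy)
  ... | inj₂ some-w with satisfied (any⁻ _ (finList (n G)) some-w)
  ... | w , uw∧wy with to T-∧ uw∧wy
  ... | uw , wy = inj₂ (w , to T-≡ uw , to T-≡ wy)

  dist-≤ : ∀ k {u v} → reach G k u v ≡ true → dist G u v ≤ k
  dist-≤ k {u} {v} = least-≤ (λ j → reach G j u v) (n G) k

  dist-adj-≤1 : ∀ {u v} → adj G u v ≡ true → dist G u v ≤ 1
  dist-adj-≤1 {v = v} uv = dist-≤ 1 (reach-suc⁺ 0 uv (reach-refl v))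

  far-≢-neighbour : ∀ {c x v} → 2 ≤ dist G c x → adj G c v ≡ true → x ≢ v
  far-≢-neighbour 2≤d cv refl = <-irrefl refl (≤-trans 2≤d (dist-adj-≤1 cv))

  ClosedNbhd⊆ : V → V → Set
  ClosedNbhd⊆ u u' = ∀ w → InClosedNbhd G u w → InClosedNbhd G u' w

  reach-transfer : ∀ {u u' y} → ClosedNbhd⊆ u u' → y ≢ u →
    ∀ k → reach G k u y ≡ true → reach G k u' y ≡ true
  reach-transfer N⊆ y≢u zero    r = contradiction (sym (reach-zero⁻ r)) y≢u
  reach-transfer N⊆ y≢u (suc k) r with reach-suc⁻ k r
  ... | inj₁ uy = reach-weaken k (reach-transfer N⊆ y≢u k uy)
  ... | inj₂ (w , uw , wy) with N⊆ w (inj₂ uw)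
  ... | inj₁ refl = reach-weaken k wy
  ... | inj₂ u'w  = reach-suc⁺ k u'w wy

  dist-antitone : ∀ {u u' y} → ClosedNbhd⊆ u u' → y ≢ u → dist G u' y ≤ dist G u y
  dist-antitone N⊆ y≢u = least-antitone _ _ (n G) (reach-transfer N⊆ y≢u)

  InNcx-closedTwin : ∀ {c x u u'} → 2 ≤ dist G c x →
    ClosedNbhd⊆ u u' → ClosedNbhd⊆ u' u → InNcx G c x u → InNcx G c x u'
  InNcx-closedTwin {c} {x} {u} {u'} 2≤d u⊆u' u'⊆u (cu , d≡) =
    twin-in-Ncx (u⊆u' c (inj₂ (trans (Graph.sym G u c) cu)))
    where
    u'-closer : dist G u' x ≤ dist G u x
    u'-closer = dist-antitone u⊆u' (far-≢-neighbour 2≤d cu)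

    twin-in-Ncx : InClosedNbhd G u' c → InNcx G c x u'
    twin-in-Ncx (inj₁ refl) = contradiction (≤-trans (≤-reflexive (sym d≡)) u'-closer) (<-irrefl refl)
    twin-in-Ncx (inj₂ u'c)  = cu' , trans d≡ (cong suc (≤-antisym u-closer u'-closer))
      where
      cu' : adj G c u' ≡ true
      cu' = trans (Graph.sym G c u') u'c
      u-closer : dist G u x ≤ dist G u' x
      u-closer = dist-antitone u'⊆u (far-≢-neighbour 2≤d cu')

  InClosedNbhd? : ∀ u w → Dec (InClosedNbhd G u w)
  InClosedNbhd? u w = (w Fin.≟ u) ⊎-dec (adj G u w Bool.≟ true)

  InNcx? : ∀ c x v → Dec (InNcx G c x v)
  InNcx? c x v = (adj G c v Bool.≟ true) ×-dec (dist G c x ℕ.≟ suc (dist G v x))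

  module _ (R : V → Bool) where

    InC-dominates : ∀ {c x u u'} → InC G R c x u → InC G R c x u' → ClosedNbhd⊆ u u'
    InC-dominates ((_ , u∈N) , _) (_ , u'-dom) = u'-dom _ u∈N

    InC-closedTwin : ∀ {c x u u'} → 2 ≤ dist G c x → R u' ≡ true →
      ClosedNbhd⊆ u u' → ClosedNbhd⊆ u' u → InC G R c x u → InC G R c x u'
    InC-closedTwin 2≤d Ru' u⊆u' u'⊆u ((_ , u∈N) , u-dom) =
      (Ru' , InNcx-closedTwin 2≤d u⊆u' u'⊆u u∈N) , λ v v∈N w vw → u⊆u' w (u-dom v v∈N w vw)

    InC-shared : ∀ {c₁ x₁ c₂ x₂ u u'} → 2 ≤ dist G c₂ x₂ →
      InC G R c₁ x₁ u → InC G R c₂ x₂ u → InC G R c₁ x₁ u' → InC G R c₂ x₂ u'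
    InC-shared 2≤d u∈C₁ u∈C₂ u'∈C₁@((Ru' , _) , _) =
      InC-closedTwin 2≤d Ru' (InC-dominates u∈C₁ u'∈C₁) (InC-dominates u'∈C₁ u∈C₁) u∈C₂

    InC? : ∀ c x u → Dec (InC G R c x u)
    InC? c x u = ((R u Bool.≟ true) ×-dec InNcx? c x u) ×-dec
      all? (λ v → InNcx? c x v →-dec all? (λ w → InClosedNbhd? v w →-dec InClosedNbhd? u w))

lemma2 : (G : Graph) → Connected G → SatisfiesP3 G →
    (R : Fin (n G) → Bool) → WitnessesP3 G R →
    (c₁ x₁ c₂ x₂ : Fin (n G)) →
    R c₁ ≡ true → 2 ≤ dist G c₁ x₁ →
    R c₂ ≡ true → 2 ≤ dist G c₂ x₂ →
    (∀ u → InC G R c₁ x₁ u ⇔ InC G R c₂ x₂ u) ⊎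
    (∀ u → ¬ (InC G R c₁ x₁ u × InC G R c₂ x₂ u))
lemma2 G _ _ R _ c₁ x₁ c₂ x₂ _ 2≤d₁ _ 2≤d₂
  with any? (λ u → InC? G R c₁ x₁ u ×-dec InC? G R c₂ x₂ u)
... | yes (u , u∈C₁ , u∈C₂) =
  inj₁ λ _ → mk⇔ (InC-shared G R 2≤d₂ u∈C₁ u∈C₂) (InC-shared G R 2≤d₁ u∈C₂ u∈C₁)
... | no no-common = inj₂ λ u u∈both → no-common (u , u∈both)
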